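{- Let $A$ be a setoid, $B$ a setoid family over $A$ and $(C,a_C)$ a $P_B$-algebra. Let $w,w':W$, $\gamma:w\approx_W w'$, $k:\mathsf{ImS}\,w\Rightarrow C$ and $k':\mathsf{ImS}\,w'\Rightarrow C$. Then \[\mathsf{RecDef}\,w\,k\to\mathsf{RecDef}\,w'\,k'\to k\approx k'\circ\mathsf{ImS}_\gamma.\]
   Context: Setting: intensional Martin-Löf type theory with $\Pi$-types and a universe $\mathsf{U}$ closed under $\Pi$ and containing intensional $\Sigma$-types, identity types, the unit type, W-types and dependent W-types (inductive families); logic is propositions-as-types. A setoid $X$ is a tuple $(X_0,\approx_X,r_X,s_X,t_X)$ with $X_0:\mathsf{U}$, $\approx_X:X_0\to X_0\to\mathsf{U}$ and witnesses of reflexivity, symmetry, transitivity; $x:X$ means $x:X_0$. An extensional function $f:X\Rightarrow Y$ is $f_0:X_0\to Y_0$ with a proof of $\prod_{x,x'}x\approx x'\to f_0x\approx f_0x'$; the setoid $X\Rightarrow Y$ has $f\approx g:=\prod_x f_0x\approx g_0x$. A setoid family $B$ over a setoid $A$ gives a setoid $B\,a$ (underlying type $B_0a$) for $a:A$ and extensional transports $B_\alpha:B\,a\Rightarrow B\,a'$ for $\alpha:a\approx_Aa'$, functorial up to $\approx$, with $B_\alpha\approx B_{\alpha'}$ for all $\alpha,\alpha':a\approx a'$. Write $b\approx_\alpha b'$ for $B_\alpha b\approx b'$. $P_BX$ is the setoid on $\sum_{a:A_0}(B\,a\Rightarrow X)$ with $(a,k)\approx(a',k'):=\sum_{\alpha:a\approx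 a'}k\approx k'\circ B_\alpha$. A $P_B$-algebra is a setoid $C$ with extensional $a_C:P_BC\Rightarrow C$. $\mathrm{W}$ is the W-type on $A_0,B_0$ with constructor $\mathsf{sup}$, and $\mathsf{n}(\mathsf{sup}\,a\,f)\equiv a$, $\mathsf{b}(\mathsf{sup}\,a\,f)\equiv f$. $\mathcal{W}_B$ is the inductive family on $\mathrm{W}\times\mathrm{W}$ with single constructor $\mathsf{dsup}\,(w,w')\,\alpha\,\phi:\mathcal{W}_B\,w\,w'$ for $\alpha:\mathsf{n}w\approx_A\mathsf{n}w'$ and $\phi:\prod_{(b,b',\beta):\sum_{b,b'}b\approx_\alpha b'}\mathcal{W}_B(\mathsf{b}\,w\,b)(\mathsf{b}\,w'\,b')$. The setoid $W$ has underlying type $\sum_w\mathcal{W}_B\,w\,w$ and $(w,\_)\approx_W(w',\_):=\mathcal{W}_B\,w\,w'$. For $\gamma:w\approx_Ww'$, $\mathsf{n}\triangleright\gamma:\mathsf{n}w\approx_A\mathsf{n}w'$ is its label component; each $\mathsf{b}\,w:B(\mathsf{n}w)\Rightarrow W$ is extensional. For $w:W$, $\mathsf{ImS}\,w$ is the setoid on $B_0(\mathsf{n}w)$ with $s\approx s':=\mathsf{b}\,w\,s\approx_W\mathsf{b}\,w\,s'$; for $\gamma:w\approx_Ww'$, $\mathsf{ImS}_\gamma:=B_{\mathsf{n}\triangleright\gamma}:\mathsf{ImS}\,w\Rightarrow\mathsf{ImS}\,w'$. $e_w:B(\mathsf{n}w)\Rightarrow\mathsf{ImS}\,w$ is the identity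 on underlying types. $\mathsf{CohMaps}\,w$ is the setoid of families $F:\prod_{s:\mathsf{ImS}\,w}\mathsf{ImS}(\mathsf{b}\,w\,s)\Rightarrow C$ such that $F\,s\approx(F\,s')\circ\mathsf{ImS}_\sigma$ for all $\sigma:\mathsf{b}\,w\,s\approx_W\mathsf{b}\,w\,s'$. For $F:\mathsf{CohMaps}\,w$, $\mathsf{recst}\,w\,F:\mathsf{ImS}\,w\Rightarrow C$ is $s\mapsto a_C(\mathsf{n}(\mathsf{b}\,w\,s),(F\,s)\circ e_{\mathsf{b}ws})$. For $k:\mathsf{ImS}\,w\Rightarrow C$, $\mathsf{RecDef}\,w\,k$ is the inductive family (dependent W-type indexed by $\sum_{w:W}(\mathsf{ImS}\,w\Rightarrow C)$) with the single constructor: from $F:\mathsf{CohMaps}\,w$, a proof of $k\approx\mathsf{recst}\,w\,F$ and $\prod_{s:B_0(\mathsf{n}w)}\mathsf{RecDef}\,(\mathsf{b}\,w\,s)\,(F\,s)$, form an element of $\mathsf{RecDef}\,w\,k$. -}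

module Defs where

open import Level using (0ℓ)
open import Data.Product using (Σ; Σ-syntax; _,_; proj₁; proj₂)
open import Relation.Binary.Bundles using (Setoid)
open import Function.Bundles using (Func; _⟨$⟩_)
import Function.Relation.Binary.Setoid.Equality as FunEq
open import Function.Construct.Composition as Comp using ()

-- Setoids are stdlib setoids with carrier and relation in Set (the universe U).
-- Extensional functions X ⇒ Y are stdlib 'Func X Y'; equality of such is
-- pointwise: FunEq._≈_ X Y f g = ∀ x → f x ≈ g x.

_∘ₑ_ : {X Y Z : Setoid 0ℓ 0ℓ} → Func Y Z → Func X Y → Func X Z
g ∘ₑ f = Comp.function f g

record Family (A : Setoid 0ℓ 0ℓ) : Set₁ where
  open Setoid A renaming (Carrier to A₀; _≈_ to _≈A_)
  field
    Fam   : A₀ → Setoid 0ℓ 0ℓ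
    tr    : {a a' : A₀} → a ≈A a' → Func (Fam a) (Fam a')
    tr-refl  : {a : A₀} (x : Setoid.Carrier (Fam a)) →
               Setoid._≈_ (Fam a) (tr (Setoid.refl A) ⟨$⟩ x) x
    tr-trans : {a a' a'' : A₀} (α : a ≈A a') (β : a' ≈A a'')
               (x : Setoid.Carrier (Fam a)) →
               Setoid._≈_ (Fam a'') (tr (Setoid.trans A α β) ⟨$⟩ x) (tr β ⟨$⟩ (tr α ⟨$⟩ x))
    tr-irr   : {a a' : A₀} (α α' : a ≈A a') (x : Setoid.Carrier (Fam a)) →
               Setoid._≈_ (Fam a') (tr α ⟨$⟩ x) (tr α' ⟨$⟩ x)

  B₀ : A₀ → Set
  B₀ a = Setoid.Carrier (Fam a)

  _≈[_]_ : {a a' : A₀} → B₀ a → a ≈A a' → B₀ a' → Set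
  b ≈[ α ] b' = Setoid._≈_ (Fam _) (tr α ⟨$⟩ b) b'

module _ (A : Setoid 0ℓ 0ℓ) (B : Family A) where
  private
    module A = Setoid A
    module B = Family B

  private
    tr-inv : {a a' : A.Carrier} (α : a A.≈ a') (y : B.B₀ a') →
             Setoid._≈_ (B.Fam a') (B.tr α ⟨$⟩ (B.tr (A.sym α) ⟨$⟩ y)) y
    tr-inv {a' = a'} α y = S.trans (S.sym (B.tr-trans (A.sym α) α y))
                            (S.trans (B.tr-irr _ A.refl y) (B.tr-refl y))
      where module S = Setoid (B.Fam a')

  P : Setoid 0ℓ 0ℓ → Setoid 0ℓ 0ℓ
  P X = record
    { Carrier = Σ[ a ∈ A.Carrier ] Func (B.Fam a) X
    ; _≈_ = λ { (a , k) (a' , k') →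
                 Σ[ α ∈ a A.≈ a' ] FunEq._≈_ (B.Fam a) X k (k' ∘ₑ B.tr α) }
    ; isEquivalence = record
      { refl = λ { {a , k} → A.refl , λ x → X.sym (Func.cong k (B.tr-refl x)) }
      ; sym = λ { {a , k} {a' , k'} (α , e) → A.sym α , λ y →
                  X.trans (Func.cong k' (Setoid.sym (B.Fam a') (tr-inv α y)))
                          (X.sym (e (B.tr (A.sym α) ⟨$⟩ y))) }
      ; trans = λ { {a , k} {a' , k'} {a'' , k''} (α , e) (β , f) →
                  A.trans α β , λ x →
                  X.trans (e x) (X.trans (f (B.tr α ⟨$⟩ x))
                    (Func.cong k'' (Setoid.sym (B.Fam a'') (B.tr-trans α β x)))) }
      }
    }
    where module X = Setoid X

  record Alg : Set₁ where
    field
      Car : Setoid 0ℓ 0ℓ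
      aC  : Func (P Car) Car

  data W : Set where
    sup : (a : A.Carrier) → (B.B₀ a → W) → W

  n : W → A.Carrier
  n (sup a f) = a

  br : (w : W) → B.B₀ (n w) → W
  br (sup a f) = f

  data 𝒲 : W → W → Set where
    dsup : (w w' : W) (α : n w A.≈ n w') →
           ((b : B.B₀ (n w)) (b' : B.B₀ (n w')) → b B.≈[ α ] b' → 𝒲 (br w b) (br w' b')) →
           𝒲 w w'

  lab : {w w' : W} → 𝒲 w w' → n w A.≈ n w'
  lab (dsup _ _ α _) = α

  private
    𝒲-sym : {w w' : W} → 𝒲 w w' → 𝒲 w' w
    𝒲-sym (dsup w w' α φ) = dsup w' w (A.sym α) λ b' b β →
      𝒲-sym (φ b b' (S.trans (S.sym (Func.cong (B.tr α) β)) (tr-inv α b')))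
      where module S = Setoid (B.Fam (n w'))

    𝒲-trans : {w w' w'' : W} → 𝒲 w w' → 𝒲 w' w'' → 𝒲 w w''
    𝒲-trans (dsup w w' α φ) (dsup .w' w'' α' φ') =
      dsup w w'' (A.trans α α') λ b b'' β →
        𝒲-trans (φ b (B.tr α ⟨$⟩ b) (Setoid.refl (B.Fam (n w'))))
                (φ' (B.tr α ⟨$⟩ b) b''
                  (Setoid.trans (B.Fam (n w'')) (Setoid.sym (B.Fam (n w'')) (B.tr-trans α α' b)) β))

  WS : Setoid 0ℓ 0ℓ
  WS = record
    { Carrier = Σ[ w ∈ W ] 𝒲 w w
    ; _≈_ = λ x y → 𝒲 (proj₁ x) (proj₁ y)
    ; isEquivalence = record
      { refl = λ { {w , p} → p }
      ; sym = 𝒲-sym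
      ; trans = 𝒲-trans }
    }

  private module WS = Setoid WS

  nS : WS.Carrier → A.Carrier
  nS x = n (proj₁ x)

  _▷_ : {x y : WS.Carrier} → (γ : x WS.≈ y) → nS x A.≈ nS y
  _▷_ = lab

  private
    brS-refl : (w : W) → 𝒲 w w → (s : B.B₀ (n w)) → 𝒲 (br w s) (br w s)
    brS-refl w (dsup .w .w α φ) s =
      φ s s (Setoid.trans (B.Fam (n w)) (B.tr-irr α A.refl s) (B.tr-refl s))

    brS₀ : (x : WS.Carrier) → B.B₀ (nS x) → WS.Carrier
    brS₀ (w , p) s = br w s , brS-refl w p s

  brS : (x : WS.Carrier) → Func (B.Fam (nS x)) WS
  brS (w , p) = record
    { to = brS₀ (w , p)
    ; cong = cong' p }
    where
      cong' : (p : 𝒲 w w) {s s' : B.B₀ (n w)} → Setoid._≈_ (B.Fam (n w)) s s' →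
              𝒲 (proj₁ (brS₀ (w , p) s)) (proj₁ (brS₀ (w , p) s'))
      cong' (dsup .w .w α φ) {s} {s'} e =
        φ s s' (Setoid.trans (B.Fam (n w))
                 (Setoid.trans (B.Fam (n w)) (B.tr-irr α A.refl s) (B.tr-refl s)) e)

  ImS : WS.Carrier → Setoid 0ℓ 0ℓ
  ImS x = record
    { Carrier = B.B₀ (nS x)
    ; _≈_ = λ s s' → (brS x ⟨$⟩ s) WS.≈ (brS x ⟨$⟩ s')
    ; isEquivalence = record
      { refl = λ {s} → WS.refl {brS x ⟨$⟩ s}
      ; sym = λ {s} {s'} → WS.sym {brS x ⟨$⟩ s} {brS x ⟨$⟩ s'}
      ; trans = λ {s} {s'} {s''} → WS.trans {brS x ⟨$⟩ s} {brS x ⟨$⟩ s'} {brS x ⟨$⟩ s''} } }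

  ImS-tr : {x y : WS.Carrier} → x WS.≈ y → Func (ImS x) (ImS y)
  ImS-tr {x} {y} γ = record
    { to = λ s → B.tr (_▷_ {x} {y} γ) ⟨$⟩ s
    ; cong = λ {s} {s'} σ →
        WS.trans {brS y ⟨$⟩ (B.tr (_▷_ {x} {y} γ) ⟨$⟩ s)} {brS x ⟨$⟩ s}
                 {brS y ⟨$⟩ (B.tr (_▷_ {x} {y} γ) ⟨$⟩ s')}
          (WS.sym {brS x ⟨$⟩ s} {brS y ⟨$⟩ (B.tr (_▷_ {x} {y} γ) ⟨$⟩ s)} (step s))
          (WS.trans {brS x ⟨$⟩ s} {brS x ⟨$⟩ s'} {brS y ⟨$⟩ (B.tr (_▷_ {x} {y} γ) ⟨$⟩ s')}
             σ (step s')) }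
    where
      step : (s : B.B₀ (nS x)) →
             (brS x ⟨$⟩ s) WS.≈ (brS y ⟨$⟩ (B.tr (_▷_ {x} {y} γ) ⟨$⟩ s))
      step s = go (proj₂ x) (proj₂ y) γ
        where
          go : (p : 𝒲 (proj₁ x) (proj₁ x)) (q : 𝒲 (proj₁ y) (proj₁ y)) (γ : 𝒲 (proj₁ x) (proj₁ y)) →
               𝒲 (proj₁ (brS (proj₁ x , p) ⟨$⟩ s))
                 (proj₁ (brS (proj₁ y , q) ⟨$⟩ (B.tr (lab γ) ⟨$⟩ s)))
          go (dsup _ _ _ _) (dsup _ _ _ _) (dsup _ _ α φ) =
            φ s (B.tr α ⟨$⟩ s) (Setoid.refl (B.Fam _))

  e : (x : WS.Carrier) → Func (B.Fam (nS x)) (ImS x)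
  e x = record { to = λ s → s ; cong = Func.cong (brS x) }

  module _ (C : Alg) where
    private
      module C = Alg C
      module CS = Setoid C.Car

    record CohMaps (x : WS.Carrier) : Set where
      field
        F   : (s : B.B₀ (nS x)) → Func (ImS (brS x ⟨$⟩ s)) C.Car
        coh : (s s' : B.B₀ (nS x)) (σ : (brS x ⟨$⟩ s) WS.≈ (brS x ⟨$⟩ s')) →
              FunEq._≈_ (ImS (brS x ⟨$⟩ s)) C.Car (F s)
                (F s' ∘ₑ ImS-tr {brS x ⟨$⟩ s} {brS x ⟨$⟩ s'} σ)

    recst : (x : WS.Carrier) → CohMaps x → Func (ImS x) C.Car
    recst x Fc = record
      { to = λ s → C.aC ⟨$⟩ (nS (brS x ⟨$⟩ s) , F s ∘ₑ e (brS x ⟨$⟩ s))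
      ; cong = λ {s} {s'} σ → Func.cong C.aC (_▷_ {brS x ⟨$⟩ s} {brS x ⟨$⟩ s'} σ , λ t → coh s s' σ t) }
      where open CohMaps Fc

    data RecDef : (x : WS.Carrier) → Func (ImS x) C.Car → Set where
      recdef : {x : WS.Carrier} {k : Func (ImS x) C.Car} (Fc : CohMaps x) →
               FunEq._≈_ (ImS x) C.Car k (recst x Fc) →
               ((s : B.B₀ (nS x)) → RecDef (brS x ⟨$⟩ s) (CohMaps.F Fc s)) →
               RecDef x k

module Submission where

-- Unfolding both
-- derivations, k ≈ recst w F and k' ≈ recst w' F', so at s : ImS w it suffices
-- to compare the roots recst w F s and recst w' F' s', where s' := B_{n▷γ} s.
-- Two general facts make this comparison possible:
--   * branch-tr: along γ : w ≈ w', the s-th subtree of w is equal to the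
--     s'-th subtree of w' (read off from the constructor of γ);
--   * recst-cong: recst-values at two positions agree as soon as the subtrees
--     there are equal (by σ) and the attached maps agree up to ImS_σ, since
--     a_C is extensional.
-- The hypothesis of recst-cong for the subtrees is exactly the statement of
-- the theorem one level down, supplied by the induction hypothesis.

open import Defs
open import Level using (0ℓ)
open import Relation.Binary.Bundles using (Setoid)
open import Function.Bundles using (Func; _⟨$⟩_)
import Function.Relation.Binary.Setoid.Equality as FunEq
import Relation.Binary.Reasoning.Setoid as SetoidReasoning
open import Data.Product using (_,_)

module _ (A : Setoid 0ℓ 0ℓ) (B : Family A) where
  open Family B using (B₀; tr)
  open Setoid (WS A B) using () renaming (Carrier to W₀; _≈_ to _≈W_)

  branch-tr : {w w' : W₀} (γ : w ≈W w') (s : B₀ (nS A B w)) →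
              (brS A B w ⟨$⟩ s) ≈W (brS A B w' ⟨$⟩ (tr (_▷_ A B {w} {w'} γ) ⟨$⟩ s))
  branch-tr {_ , dsup _ _ _ _} {_ , dsup _ _ _ _} (dsup _ _ α φ) s =
    φ s (tr α ⟨$⟩ s) (Setoid.refl (Family.Fam B _))

  module _ (C : Alg A B) where
    open Alg C using (Car; aC)

    recst-cong : (w w' : W₀) (F : CohMaps A B C w) (F' : CohMaps A B C w')
                 (s : B₀ (nS A B w)) (s' : B₀ (nS A B w'))
                 (σ : (brS A B w ⟨$⟩ s) ≈W (brS A B w' ⟨$⟩ s')) →
                 FunEq._≈_ (ImS A B (brS A B w ⟨$⟩ s)) Car
                   (CohMaps.F F s)
                   (CohMaps.F F' s' ∘ₑ ImS-tr A B {brS A B w ⟨$⟩ s} {brS A B w' ⟨$⟩ s'} σ) →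
                 Setoid._≈_ Car (recst A B C w F ⟨$⟩ s) (recst A B C w' F' ⟨$⟩ s')
    recst-cong w w' F F' s s' σ F≈F' =
      Func.cong aC (_▷_ A B {brS A B w ⟨$⟩ s} {brS A B w' ⟨$⟩ s'} σ , F≈F')

proposition3p12 : (A : Setoid 0ℓ 0ℓ) (B : Family A) (C : Alg A B)
    (w w' : Setoid.Carrier (WS A B)) (γ : Setoid._≈_ (WS A B) w w')
    (k : Func (ImS A B w) (Alg.Car C)) (k' : Func (ImS A B w') (Alg.Car C)) →
    RecDef A B C w k → RecDef A B C w' k' →
    FunEq._≈_ (ImS A B w) (Alg.Car C) k (k' ∘ₑ ImS-tr A B {w} {w'} γ)
proposition3p12 A B C w w' γ k k' (recdef F k≈ rec) (recdef F' k'≈ rec') s =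
  begin
    k ⟨$⟩ s                   ≈⟨ k≈ s ⟩
    recst A B C w F ⟨$⟩ s     ≈⟨ recst-cong A B C w w' F F' s s' σ subtrees-agree ⟩
    recst A B C w' F' ⟨$⟩ s'  ≈⟨ sym (k'≈ s') ⟩
    k' ⟨$⟩ s'                 ∎
  where
    open SetoidReasoning (Alg.Car C)
    open Setoid (Alg.Car C) using (sym)
    s' = Family.tr B (_▷_ A B {w} {w'} γ) ⟨$⟩ s
    σ = branch-tr A B {w} {w'} γ s
    subtrees-agree = proposition3p12 A B C (brS A B w ⟨$⟩ s) (brS A B w' ⟨$⟩ s') σ
                       (CohMaps.F F s) (CohMaps.F F' s') (rec s) (rec' s')
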